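{- Let $a\in\mathbb{N}$ with $a\geq 3$, and let $S(a)$ be the submonoid of $(\mathbb{N},+)$ generated by $\{f_a+f_n\mid n\in\mathbb{N}\}$. Then the genus of $S(a)$ is $\mathrm{g}(S(a))=\frac{a-2}{5}f_a+\frac{a}{5}f_{a-2}$.
   Context: $\{f_n\}$ is the Fibonacci sequence ($f_0=0$, $f_1=1$, $f_{n+2}=f_{n+1}+f_n$). $S(a)$ is a numerical semigroup; its genus $\mathrm{g}(S(a))$ is the cardinality of $\mathbb{N}\setminus S(a)$. -}

module Defs where

open import Data.Nat using (ℕ; zero; suc; _+_)
open import Data.List using (List; length)
open import Data.List.Membership.Propositional using (_∈_)
open import Data.List.Relation.Unary.Unique.Propositional using (Unique)
open import Data.Product using (Σ; _×_)
open import Function.Bundles using (_⇔_)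
open import Relation.Nullary using (¬_)
open import Relation.Binary.PropositionalEquality using (_≡_)

fib : ℕ → ℕ
fib zero = zero
fib (suc zero) = suc zero
fib (suc (suc n)) = fib (suc n) + fib n

-- S a : the submonoid of (ℕ,+) generated by { fib a + fib n | n ∈ ℕ },
-- i.e. the finite sums of generators (empty sum = 0).
data InS (a : ℕ) : ℕ → Set where
  s-zero : InS a zero
  s-step : ∀ {x} (n : ℕ) → InS a x → InS a (x + (fib a + fib n))

-- ℕ ∖ S a is finite of cardinality g: it is enumerated without repetition
-- by a list of length g.
HasGenus : ℕ → ℕ → Set
HasGenus a g =
  Σ (List ℕ) λ L → Unique L × (∀ x → (x ∈ L) ⇔ (¬ InS a x)) × length L ≡ g

-- Let m = fib a and let zeck y be the number of terms of the Zeckendorf (greedy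
-- Fibonacci) representation of y, so zeck (fib (k+1) + d) = 1 + zeck d for d < fib k.
-- The numbers x with zeck (x mod m) ≤ x div m are closed under addition: zeck is
-- subadditive, and a carry costs nothing since zeck t ≤ zeck (m + t) for t < m.  They
-- contain the generators m + fib n: for n < a because fib n < m and zeck (fib n) ≤ 1,
-- m + fib a = 2 m, and fib (a+1+o) = fib (2+o) m + fib (1+o) fib (a−1) makes
-- m + fib (a+1+o) a sum of copies of m and of m + fib (a−1).  Conversely y + q m with
-- zeck y ≤ q is the sum of the generators m + fib j over the Zeckendorf terms fib j
-- of y and of q − zeck y copies of m + fib 0.  So the gaps of S(a) are the i + q m
-- with i < m and q < zeck i, and g(S(a)) = Σ_{i < fib a} zeck i.  Splitting
-- [0, fib (k+2)) into [0, fib (k+1)) and fib (k+1) + [0, fib k) gives the recurrence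
-- G (k+2) = G (k+1) + fib k + G k for these sums, which the formula solves.

module Submission where

open import Defs
open import Data.Nat
  using (ℕ; zero; suc; _+_; _*_; _∸_; _≤_; _<_; z≤n; s≤s; s≤s⁻¹; _<?_; _≤?_; _<ᵇ_; NonZero; >-nonZero)
open import Data.Nat.Properties
open import Algebra.Properties.CommutativeSemigroup +-commutativeSemigroup using (x∙yz≈y∙xz)
open import Data.Nat.DivMod using (_%_; _/_; m≡m%n+[m/n]*n; m%n<n; [m+kn]%n≡m%n; m<n⇒m%n≡m; +-distrib-/-∣ʳ; m<n⇒m/n≡0; m*n/n≡m)
open import Data.Nat.Divisibility using (divides-refl)
open import Data.Nat.Tactic.RingSolver using (solve-∀)
open import Data.Product using (Σ; ∃; _×_; _,_; proj₁; proj₂)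
open import Data.Sum using (_⊎_; inj₁; inj₂)
open import Data.List using (List; []; _++_; applyUpTo; length)
open import Data.List.Properties using (length-++; length-applyUpTo)
open import Data.List.Membership.Propositional using (_∈_)
open import Data.List.Membership.Propositional.Properties using (∈-applyUpTo⁺; ∈-applyUpTo⁻; ∈-++⁺ˡ; ∈-++⁺ʳ; ∈-++⁻)
open import Data.List.Relation.Unary.Unique.Propositional using (Unique)
open import Data.List.Relation.Unary.Unique.Propositional.Properties using (++⁺; applyUpTo⁺₁)
open import Data.List.Relation.Unary.AllPairs using ([])
open import Function.Bundles using (_⇔_; mk⇔)
open import Relation.Nullary using (¬_; yes; no; contradiction)
open import Data.Bool using (true; false; if_then_else_)
open import Data.Unit using (tt)
open import Relation.Binary.PropositionalEquality

below-or-above : ∀ n y → y < n ⊎ ∃ λ d → y ≡ n + d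
below-or-above n y with y <? n
... | yes y<n = inj₁ y<n
... | no y≮n with m≤n⇒∃[o]m+o≡n (≮⇒≥ y≮n)
...   | d , n+d≡y = inj₂ (d , sym n+d≡y)

fib-mono-≤ : ∀ {m n} → m ≤ n → fib m ≤ fib n
fib-mono-≤ {m} {n} m≤n with m≤n⇒∃[o]m+o≡n m≤n
... | o , refl = go m o
  where
  go : ∀ m o → fib m ≤ fib (m + o)
  go zero o = z≤n
  go (suc m) zero = ≤-reflexive (cong fib (sym (+-identityʳ (suc m))))
  go (suc m) (suc o) rewrite +-suc m o = ≤-trans (go (suc m) o) (m≤m+n _ _)

0<fib[1+n] : ∀ n → 0 < fib (suc n)
0<fib[1+n] n = fib-mono-≤ {1} {suc n} (s≤s z≤n)

n<fib[2+n] : ∀ n → n < fib (suc (suc n))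
n<fib[2+n] zero = s≤s z≤n
n<fib[2+n] (suc n) = subst (_≤ fib (3 + n)) (+-comm (suc n) 1) (+-mono-≤ (n<fib[2+n] n) (0<fib[1+n] n))

fib-+ : ∀ n k → fib (suc n + k) ≡ fib (suc k) * fib (suc n) + fib k * fib n
fib-+ zero k = solve-fib-+ (fib (suc k)) (fib k)
  where
  solve-fib-+ : ∀ x y → x ≡ x * 1 + y * 0
  solve-fib-+ = solve-∀
fib-+ (suc n) k = begin
  fib (suc (suc n) + k)                                   ≡⟨ cong fib (sym (+-suc (suc n) k)) ⟩
  fib (suc n + suc k)                                     ≡⟨ fib-+ n (suc k) ⟩
  fib (suc (suc k)) * fib (suc n) + fib (suc k) * fib n   ≡⟨ regroup (fib (suc k)) (fib k) (fib (suc n)) (fib n) ⟩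
  fib (suc k) * fib (suc (suc n)) + fib k * fib (suc n)   ∎
  where
  open ≡-Reasoning
  regroup : ∀ x y u v → (x + y) * u + x * v ≡ x * (u + v) + y * u
  regroup = solve-∀

-- greedy k y counts the parts of the greedy Fibonacci decomposition of y, given y < fib (suc k).
greedy : ℕ → ℕ → ℕ
greedy zero y = 0
greedy (suc zero) y = 0
greedy (suc (suc k)) y =
  if y <ᵇ fib (suc k) then greedy (suc k) y else suc (greedy k (y ∸ fib (suc k)))

zeck : ℕ → ℕ
zeck y = greedy (suc (suc y)) y

greedy-below : ∀ {k y} → y < fib (suc k) → greedy (suc (suc k)) y ≡ greedy (suc k) y
greedy-below {k} {y} y< with y <ᵇ fib (suc k) | <⇒<ᵇ y<
... | true | _ = refl

greedy-above : ∀ {k y} → fib (suc k) ≤ y → greedy (suc (suc k)) y ≡ suc (greedy k (y ∸ fib (suc k)))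
greedy-above {k} {y} ≤y with y <ᵇ fib (suc k) | <ᵇ⇒< y (fib (suc k))
... | true | y< = contradiction ≤y (<⇒≱ (y< tt))
... | false | _ = refl

greedy-stable : ∀ {k y} l → y < fib (suc k) → k ≤ l → greedy (suc l) y ≡ greedy (suc k) y
greedy-stable zero y< z≤n = refl
greedy-stable {k} (suc l) y< k≤1+l with m≤n⇒m<n∨m≡n k≤1+l
... | inj₂ refl = refl
... | inj₁ (s≤s k≤l) =
  trans (greedy-below {l} (<-≤-trans y< (fib-mono-≤ (s≤s k≤l)))) (greedy-stable l y< k≤l)

zeck-greedy : ∀ {k y} → y < fib (suc k) → zeck y ≡ greedy (suc k) y
zeck-greedy {k} {y} y< = begin
  greedy (suc (suc y)) y     ≡⟨ greedy-stable (k + suc y) (n<fib[2+n] y) (m≤n+m (suc y) k) ⟨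
  greedy (suc (k + suc y)) y ≡⟨ greedy-stable (k + suc y) y< (m≤m+n k (suc y)) ⟩
  greedy (suc k) y           ∎
  where open ≡-Reasoning

zeck-fib+ : ∀ k {d} → d < fib k → zeck (fib (suc k) + d) ≡ suc (zeck d)
zeck-fib+ (suc k) {d} d< = begin
  zeck (F + d)                        ≡⟨ zeck-greedy {suc (suc k)} (+-monoʳ-< F d<) ⟩
  greedy (suc (suc (suc k))) (F + d)  ≡⟨ greedy-above {suc k} (m≤m+n F d) ⟩
  suc (greedy (suc k) (F + d ∸ F))    ≡⟨ cong (λ t → suc (greedy (suc k) t)) (m+n∸m≡n F d) ⟩
  suc (greedy (suc k) d)              ≡⟨ cong suc (zeck-greedy {k} d<) ⟨
  suc (zeck d)                        ∎
  where
  open ≡-Reasoning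
  F : ℕ
  F = fib (suc (suc k))

module _ {ℓ} (P : ℕ → Set ℓ) (P0 : P 0) (step : ∀ k {d} → d < fib k → P d → P (fib (suc k) + d)) where

  private
    Below : ℕ → Set ℓ
    Below l = ∀ y → y < fib l → P y

    below-step : ∀ l → Below (suc l) → Below l → Below (suc (suc l))
    below-step l below₁ below₀ y y< with below-or-above (fib (suc l)) y
    ... | inj₁ y<' = below₁ y y<'
    ... | inj₂ (d , refl) = step l d< (below₀ d d<)
      where
      d< : d < fib l
      d< = +-cancelˡ-< (fib (suc l)) d (fib l) y<

    below : ∀ l → Below l
    below (suc zero) zero _ = P0
    below (suc zero) (suc y) (s≤s ())
    below (suc (suc l)) = below-step l (below (suc l)) (below l)

  zeck-ind : ∀ y → P y
  zeck-ind y = below (suc (suc y)) y (n<fib[2+n] y)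

zeck-fib+-cases : ∀ k {t} → t < fib (suc (suc k)) →
  zeck (fib (suc (suc k)) + t) ≡ suc (zeck t) ⊎ zeck (fib (suc (suc k)) + t) ≡ zeck t
zeck-fib+-cases k {t} t< with below-or-above (fib (suc k)) t
... | inj₁ t<' = inj₁ (zeck-fib+ (suc k) t<')
... | inj₂ (d , refl) = inj₂ (begin
  zeck (fib (2 + k) + (fib (suc k) + d))  ≡⟨ cong zeck (+-assoc (fib (2 + k)) (fib (suc k)) d) ⟨
  zeck (fib (3 + k) + d)                  ≡⟨ zeck-fib+ (2 + k) (<-≤-trans d<fib[k] (fib-mono-≤ (m≤n+m k 2))) ⟩
  suc (zeck d)                            ≡⟨ zeck-fib+ k d<fib[k] ⟨
  zeck (fib (suc k) + d)                  ∎)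
  where
  open ≡-Reasoning
  d<fib[k] : d < fib k
  d<fib[k] = +-cancelˡ-< (fib (suc k)) d (fib k) t<

zeck-fib+-≤ : ∀ k {t} → t < fib (suc (suc k)) → zeck (fib (suc (suc k)) + t) ≤ suc (zeck t)
zeck-fib+-≤ k t< with zeck-fib+-cases k t<
... | inj₁ eq = ≤-reflexive eq
... | inj₂ eq = ≤-trans (≤-reflexive eq) (n≤1+n _)

zeck-≤-fib+ : ∀ k {t} → t < fib (suc (suc k)) → zeck t ≤ zeck (fib (suc (suc k)) + t)
zeck-≤-fib+ k t< with zeck-fib+-cases k t<
... | inj₁ eq = ≤-trans (n≤1+n _) (≤-reflexive (sym eq))
... | inj₂ eq = ≤-reflexive (sym eq)

zeck-+fib-≤ : ∀ y j → zeck (y + fib j) ≤ suc (zeck y)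
zeck-+fib-≤ = zeck-ind (λ y → ∀ j → zeck (y + fib j) ≤ suc (zeck y)) zeck-fib≤1 step
  where
  zeck-fib≤1 : ∀ j → zeck (fib j) ≤ 1
  zeck-fib≤1 zero = z≤n
  zeck-fib≤1 (suc zero) = ≤-refl
  zeck-fib≤1 (suc (suc j)) =
    subst (λ x → zeck x ≤ 1) (+-identityʳ (fib (2 + j))) (zeck-fib+-≤ j (0<fib[1+n] (suc j)))

  step : ∀ k {d} → d < fib k → (∀ j → zeck (d + fib j) ≤ suc (zeck d)) →
         ∀ j → zeck ((fib (suc k) + d) + fib j) ≤ suc (zeck (fib (suc k) + d))
  step (suc k) {d} d< ih j rewrite zeck-fib+ (suc k) d< = bound j
    where
    open ≤-Reasoning
    b c y : ℕ
    b = fib (suc k)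
    c = fib k
    y = fib (2 + k) + d

    bound : ∀ j → zeck (y + fib j) ≤ 2 + zeck d
    bound j with j ≤? 2 + k
    bound j | no j≰ with ≰⇒> j≰
    bound (suc (suc j)) | no _ | 3+k≤2+j@(s≤s (s≤s _)) = begin
      zeck (y + fib (2 + j))  ≡⟨ cong zeck (+-comm y (fib (2 + j))) ⟩
      zeck (fib (2 + j) + y)  ≤⟨ zeck-fib+-≤ j (<-≤-trans (+-monoʳ-< (fib (2 + k)) d<) (fib-mono-≤ 3+k≤2+j)) ⟩
      suc (zeck y)            ≡⟨ cong suc (zeck-fib+ (suc k) d<) ⟩
      2 + zeck d              ∎
    bound j | yes j≤2+k with m≤n⇒m<n∨m≡n j≤2+k
    -- 2 fib (2+k) = fib (3+k) + fib k
    bound j | yes _ | inj₂ refl = begin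
      zeck (y + fib (2 + k))        ≡⟨ cong zeck (regroup b c d) ⟩
      zeck (fib (3 + k) + (d + c))  ≡⟨ zeck-fib+ (2 + k) (+-monoˡ-< c d<) ⟩
      suc (zeck (d + c))            ≤⟨ s≤s (ih k) ⟩
      2 + zeck d                    ∎
      where
      regroup : ∀ b c d → ((b + c) + d) + (b + c) ≡ ((b + c) + b) + (d + c)
      regroup = solve-∀
    bound j | yes _ | inj₁ (s≤s j≤1+k) with m≤n⇒m<n∨m≡n j≤1+k
    ... | inj₂ refl = begin
      zeck (y + fib (1 + k))  ≡⟨ cong zeck (regroup b c d) ⟩
      zeck (fib (3 + k) + d)  ≡⟨ zeck-fib+ (2 + k) (<-≤-trans d< (fib-mono-≤ (n≤1+n (suc k)))) ⟩
      suc (zeck d)            ≤⟨ n≤1+n _ ⟩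
      2 + zeck d              ∎
      where
      regroup : ∀ b c d → ((b + c) + d) + b ≡ ((b + c) + b) + d
      regroup = solve-∀
    ... | inj₁ (s≤s j≤k) = begin
      zeck (y + fib j)          ≡⟨ cong zeck (+-assoc (fib (2 + k)) d (fib j)) ⟩
      zeck (fib (2 + k) + (d + fib j))
        ≤⟨ zeck-fib+-≤ k (+-mono-<-≤ d< (fib-mono-≤ j≤k)) ⟩
      suc (zeck (d + fib j))    ≤⟨ s≤s (ih j) ⟩
      2 + zeck d                ∎

zeck-+-≤ : ∀ x y → zeck (x + y) ≤ zeck x + zeck y
zeck-+-≤ x = zeck-ind (λ y → zeck (x + y) ≤ zeck x + zeck y) x+0 step
  where
  open ≤-Reasoning
  x+0 : zeck (x + 0) ≤ zeck x + zeck 0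
  x+0 = ≤-reflexive (trans (cong zeck (+-identityʳ x)) (sym (+-identityʳ (zeck x))))

  step : ∀ k {d} → d < fib k → zeck (x + d) ≤ zeck x + zeck d →
         zeck (x + (fib (suc k) + d)) ≤ zeck x + zeck (fib (suc k) + d)
  step k {d} d< ih = begin
    zeck (x + (fib (suc k) + d))   ≡⟨ cong zeck (regroup x (fib (suc k)) d) ⟩
    zeck ((x + d) + fib (suc k))   ≤⟨ zeck-+fib-≤ (x + d) (suc k) ⟩
    suc (zeck (x + d))             ≤⟨ s≤s ih ⟩
    suc (zeck x + zeck d)          ≡⟨ +-suc (zeck x) (zeck d) ⟨
    zeck x + suc (zeck d)          ≡⟨ cong (zeck x +_) (zeck-fib+ k d<) ⟨
    zeck x + zeck (fib (suc k) + d) ∎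
    where
    regroup : ∀ x f d → x + (f + d) ≡ (x + d) + f
    regroup = solve-∀

InS-multiple : ∀ a q → InS a (q * fib a)
InS-multiple a zero = s-zero
InS-multiple a (suc q) = subst (InS a) (regroup (q * fib a) (fib a)) (s-step 0 (InS-multiple a q))
  where
  regroup : ∀ x m → x + (m + 0) ≡ m + x
  regroup = solve-∀

InS-+* : ∀ a y q → zeck y ≤ q → InS a (y + q * fib a)
InS-+* a = zeck-ind (λ y → ∀ q → zeck y ≤ q → InS a (y + q * fib a)) (λ q _ → InS-multiple a q) step
  where
  step : ∀ k {d} → d < fib k → (∀ q → zeck d ≤ q → InS a (d + q * fib a)) →
         ∀ q → zeck (fib (suc k) + d) ≤ q → InS a ((fib (suc k) + d) + q * fib a)
  step k d< ih zero zeck≤0 = contradiction (subst (_≤ 0) (zeck-fib+ k d<) zeck≤0) λ ()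
  step k {d} d< ih (suc q) zeck≤1+q =
    subst (InS a) (regroup d (q * fib a) (fib a) (fib (suc k)))
      (s-step (suc k) (ih q (s≤s⁻¹ (subst (_≤ suc q) (zeck-fib+ k d<) zeck≤1+q))))
    where
    regroup : ∀ d x m f → (d + x) + (m + f) ≡ (f + d) + (m + x)
    regroup = solve-∀

sumBelow : (ℕ → ℕ) → ℕ → ℕ
sumBelow f zero = 0
sumBelow f (suc n) = f n + sumBelow f n

sumBelow-+ : ∀ f m n → sumBelow f (m + n) ≡ sumBelow f m + sumBelow (λ t → f (m + t)) n
sumBelow-+ f m zero = trans (cong (sumBelow f) (+-identityʳ m)) (sym (+-identityʳ _))
sumBelow-+ f m (suc n) = begin
  sumBelow f (m + suc n)                                     ≡⟨ cong (sumBelow f) (+-suc m n) ⟩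
  f (m + n) + sumBelow f (m + n)                             ≡⟨ cong (f (m + n) +_) (sumBelow-+ f m n) ⟩
  f (m + n) + (sumBelow f m + sumBelow (λ t → f (m + t)) n)  ≡⟨ x∙yz≈y∙xz (f (m + n)) (sumBelow f m) _ ⟩
  sumBelow f m + (f (m + n) + sumBelow (λ t → f (m + t)) n)  ∎
  where open ≡-Reasoning

sumBelow-suc-cong : ∀ {f g} n → (∀ {t} → t < n → f t ≡ suc (g t)) → sumBelow f n ≡ n + sumBelow g n
sumBelow-suc-cong zero _ = refl
sumBelow-suc-cong {f} {g} (suc n) f≡1+g =
  trans (cong₂ _+_ (f≡1+g ≤-refl) (sumBelow-suc-cong n (λ t< → f≡1+g (m<n⇒m<1+n t<))))
        (cong suc (x∙yz≈y∙xz (g n) n _))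

sumBelow-zeck-fib : ∀ k →
  sumBelow zeck (fib (suc (suc k))) ≡ sumBelow zeck (fib (suc k)) + (fib k + sumBelow zeck (fib k))
sumBelow-zeck-fib k =
  trans (sumBelow-+ zeck (fib (suc k)) (fib k))
        (cong (sumBelow zeck (fib (suc k)) +_) (sumBelow-suc-cong (fib k) (zeck-fib+ k)))

5*sumBelow-zeck-fib : ∀ n → 5 * sumBelow zeck (fib (2 + n)) ≡ n * fib (2 + n) + (2 + n) * fib n
5*sumBelow-zeck-fib zero = refl
5*sumBelow-zeck-fib (suc zero) = refl
5*sumBelow-zeck-fib (suc (suc n)) = begin
  5 * G (4 + n)                                     ≡⟨ cong (5 *_) (sumBelow-zeck-fib (2 + n)) ⟩
  5 * (G (3 + n) + (fib (2 + n) + G (2 + n)))       ≡⟨ distrib (G (3 + n)) (fib (2 + n)) (G (2 + n)) ⟩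
  5 * G (3 + n) + 5 * G (2 + n) + 5 * fib (2 + n)
    ≡⟨ cong₂ (λ u v → u + v + 5 * fib (2 + n)) (5*sumBelow-zeck-fib (suc n)) (5*sumBelow-zeck-fib n) ⟩
  (1 + n) * fib (3 + n) + (3 + n) * fib (1 + n) + (n * fib (2 + n) + (2 + n) * fib n) + 5 * fib (2 + n)
    ≡⟨ fib-polynomial n (fib (suc n)) (fib n) ⟩
  (2 + n) * fib (4 + n) + (4 + n) * fib (2 + n)     ∎
  where
  open ≡-Reasoning
  G : ℕ → ℕ
  G k = sumBelow zeck (fib k)
  distrib : ∀ x y z → 5 * (x + (y + z)) ≡ 5 * x + 5 * z + 5 * y
  distrib = solve-∀
  fib-polynomial : ∀ n b a →
    (1 + n) * ((b + a) + b) + (3 + n) * b + (n * (b + a) + (2 + n) * a) + 5 * (b + a)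
      ≡ (2 + n) * (((b + a) + b) + (b + a)) + (4 + n) * (b + a)
  fib-polynomial = solve-∀

[i+qn]%n≡i : ∀ {i} q n .{{_ : NonZero n}} → i < n → (i + q * n) % n ≡ i
[i+qn]%n≡i {i} q n i<n = trans ([m+kn]%n≡m%n i q n) (m<n⇒m%n≡m i<n)

[i+qn]/n≡q : ∀ {i} q n .{{_ : NonZero n}} → i < n → (i + q * n) / n ≡ q
[i+qn]/n≡q {i} q n i<n =
  trans (+-distrib-/-∣ʳ i (divides-refl q)) (cong₂ _+_ (m<n⇒m/n≡0 i<n) (m*n/n≡m q n))

module Gaps (m : ℕ) .{{_ : NonZero m}} (h : ℕ → ℕ) where

  block : ℕ → List ℕ
  block i = applyUpTo (λ q → i + q * m) (h i)

  gaps : ℕ → List ℕ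
  gaps zero = []
  gaps (suc i) = block i ++ gaps i

  length-gaps : ∀ n → length (gaps n) ≡ sumBelow h n
  length-gaps zero = refl
  length-gaps (suc n) =
    trans (length-++ (block n)) (cong₂ _+_ (length-applyUpTo _ (h n)) (length-gaps n))

  ∈-block⁻ : ∀ {i x} → i < m → x ∈ block i → x % m ≡ i × x / m < h i
  ∈-block⁻ {i} i<m x∈ with ∈-applyUpTo⁻ _ x∈
  ... | q , q<h , refl = [i+qn]%n≡i q m i<m , subst (_< h i) (sym ([i+qn]/n≡q q m i<m)) q<h

  ∈-gaps⁻ : ∀ {n x} → n ≤ m → x ∈ gaps n → x % m < n × x / m < h (x % m)
  ∈-gaps⁻ {suc n} {x} n<m x∈ with ∈-++⁻ (block n) x∈
  ... | inj₁ x∈block =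
    let r≡n , q<h = ∈-block⁻ n<m x∈block
    in ≤-reflexive (cong suc r≡n) , subst (λ i → x / m < h i) (sym r≡n) q<h
  ... | inj₂ x∈gaps =
    let r<n , q<h = ∈-gaps⁻ (<⇒≤ n<m) x∈gaps
    in m<n⇒m<1+n r<n , q<h

  ∈-gaps⁺ : ∀ {n x} → x % m < n → x / m < h (x % m) → x ∈ gaps n
  ∈-gaps⁺ {suc n} {x} r<1+n q<h with m≤n⇒m<n∨m≡n (s≤s⁻¹ r<1+n)
  ... | inj₁ r<n = ∈-++⁺ʳ (block n) (∈-gaps⁺ r<n q<h)
  ... | inj₂ refl = ∈-++⁺ˡ (subst (_∈ block (x % m)) (sym (m≡m%n+[m/n]*n x m)) (∈-applyUpTo⁺ _ q<h))

  block-unique : ∀ i → Unique (block i)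
  block-unique i = applyUpTo⁺₁ _ (h i) λ q<r _ eq → <⇒≢ q<r (*-cancelʳ-≡ _ _ m (+-cancelˡ-≡ i _ _ eq))

  gaps-unique : ∀ {n} → n ≤ m → Unique (gaps n)
  gaps-unique {zero} _ = []
  gaps-unique {suc n} n<m = ++⁺ (block-unique n) (gaps-unique (<⇒≤ n<m)) disjoint
    where
    disjoint : ∀ {x} → ¬ (x ∈ block n × x ∈ gaps n)
    disjoint (x∈b , x∈g) =
      <-irrefl (proj₁ (∈-block⁻ n<m x∈b)) (proj₁ (∈-gaps⁻ (<⇒≤ n<m) x∈g))

module FibonacciSemigroup (c : ℕ) where

  a : ℕ
  a = 3 + c

  m : ℕ
  m = fib a

  0<m : 0 < m
  0<m = 0<fib[1+n] (2 + c)

  instance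
    m-nonZero : NonZero m
    m-nonZero = >-nonZero 0<m

  Admissible : ℕ → Set
  Admissible x = zeck (x % m) ≤ x / m

  admissible-+* : ∀ {i} q → i < m → zeck i ≤ q → Admissible (i + q * m)
  admissible-+* q i<m zeck-i≤q =
    subst₂ _≤_ (cong zeck (sym ([i+qn]%n≡i q m i<m))) (sym ([i+qn]/n≡q q m i<m)) zeck-i≤q

  admissible-0 : Admissible 0
  admissible-0 = admissible-+* 0 0<m z≤n

  admissible-+ : ∀ {x y} → Admissible x → Admissible y → Admissible (x + y)
  admissible-+ {x} {y} adm-x adm-y =
    subst Admissible (sym x+y≡) (carry (below-or-above m (i + j)))
    where
    i j q r : ℕ
    i = x % m
    j = y % m
    q = x / m
    r = y / m

    x+y≡ : x + y ≡ (i + j) + (q + r) * m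
    x+y≡ = trans (cong₂ _+_ (m≡m%n+[m/n]*n x m) (m≡m%n+[m/n]*n y m)) (regroup i q j r m)
      where
      regroup : ∀ i q j r m → (i + q * m) + (j + r * m) ≡ (i + j) + (q + r) * m
      regroup = solve-∀

    zeck-i+j≤q+r : zeck (i + j) ≤ q + r
    zeck-i+j≤q+r = ≤-trans (zeck-+-≤ i j) (+-mono-≤ adm-x adm-y)

    carry : i + j < m ⊎ ∃ (λ t → i + j ≡ m + t) → Admissible ((i + j) + (q + r) * m)
    carry (inj₁ i+j<m) = admissible-+* (q + r) i+j<m zeck-i+j≤q+r
    carry (inj₂ (t , i+j≡m+t)) =
      subst Admissible (sym (trans (cong (_+ (q + r) * m) i+j≡m+t) (regroup m t (q + r))))
        (admissible-+* (suc (q + r)) t<m (≤-trans zeck-t≤ (n≤1+n (q + r))))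
      where
      t<m : t < m
      t<m = +-cancelˡ-< m t m (subst (_< m + m) i+j≡m+t (+-mono-< (m%n<n x m) (m%n<n y m)))
      zeck-t≤ : zeck t ≤ q + r
      zeck-t≤ = ≤-trans (zeck-≤-fib+ (suc c) t<m) (subst (λ s → zeck s ≤ q + r) i+j≡m+t zeck-i+j≤q+r)
      regroup : ∀ m t k → (m + t) + k * m ≡ t + (m + k * m)
      regroup = solve-∀

  admissible-* : ∀ k {x} → Admissible x → Admissible (k * x)
  admissible-* zero _ = admissible-0
  admissible-* (suc k) adm = admissible-+ adm (admissible-* k adm)

  admissible-gen-below : ∀ {n} → n ≤ 2 + c → Admissible (m + fib n)
  admissible-gen-below {n} n≤2+c =
    subst Admissible (trans (cong (fib n +_) (*-identityˡ m)) (+-comm (fib n) m))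
      (admissible-+* 1 fib[n]<m (zeck-+fib-≤ 0 n))
    where
    fib[n]<m : fib n < m
    fib[n]<m = ≤-<-trans (fib-mono-≤ n≤2+c) (m<m+n (fib (2 + c)) (0<fib[1+n] c))

  admissible-gen-above : ∀ o → Admissible (m + fib (a + o))
  admissible-gen-above zero =
    subst Admissible (cong (λ n → m + fib n) (sym (+-identityʳ a))) m+m-admissible
    where
    m+m-admissible : Admissible (m + m)
    m+m-admissible = subst Admissible (cong (m +_) (+-identityʳ m)) (admissible-+* 2 0<m z≤n)
  admissible-gen-above (suc o) =
    subst Admissible (sym m+fib[a+1+o]≡)
      (admissible-+ (admissible-* (fib (suc o)) (admissible-gen-below ≤-refl))
                    (admissible-+* (suc (fib o)) 0<m z≤n))
    where
    m+fib[a+1+o]≡ : m + fib (a + suc o) ≡ fib (suc o) * (m + fib (2 + c)) + (0 + suc (fib o) * m)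
    m+fib[a+1+o]≡ = trans (cong (m +_) (fib-+ (2 + c) (suc o)))
                          (regroup m (fib (suc o)) (fib o) (fib (2 + c)))
      where
      regroup : ∀ m u v b → m + ((u + v) * m + u * b) ≡ u * (m + b) + (0 + suc v * m)
      regroup = solve-∀

  admissible-gen : ∀ n → Admissible (m + fib n)
  admissible-gen n with n ≤? 2 + c
  ... | yes n≤2+c = admissible-gen-below n≤2+c
  ... | no n≰2+c with m≤n⇒∃[o]m+o≡n (≰⇒> n≰2+c)
  ...   | o , refl = admissible-gen-above o

  InS⇒admissible : ∀ {x} → InS a x → Admissible x
  InS⇒admissible s-zero = admissible-0
  InS⇒admissible (s-step n x∈S) = admissible-+ (InS⇒admissible x∈S) (admissible-gen n)

  admissible⇒InS : ∀ {x} → Admissible x → InS a x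
  admissible⇒InS {x} adm = subst (InS a) (sym (m≡m%n+[m/n]*n x m)) (InS-+* a (x % m) (x / m) adm)

  open Gaps m zeck

  ∈-gaps⇔gap : ∀ x → (x ∈ gaps m) ⇔ (¬ InS a x)
  ∈-gaps⇔gap x = mk⇔
    (λ x∈ x∈S → <⇒≱ (proj₂ (∈-gaps⁻ ≤-refl x∈)) (InS⇒admissible x∈S))
    (λ x∉S → ∈-gaps⁺ (m%n<n x m) (≰⇒> (λ adm → x∉S (admissible⇒InS adm))))

  genus : HasGenus a (sumBelow zeck m)
  genus = gaps m , gaps-unique ≤-refl , ∈-gaps⇔gap , length-gaps m

theorem33 : (a : ℕ) → 3 ≤ a →
    Σ ℕ λ g → HasGenus a g × 5 * g ≡ (a ∸ 2) * fib a + a * fib (a ∸ 2)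
theorem33 (suc (suc (suc c))) _ =
  sumBelow zeck (fib (3 + c)) , FibonacciSemigroup.genus c , 5*sumBelow-zeck-fib (suc c)
theorem33 (suc zero) (s≤s ())
theorem33 (suc (suc zero)) (s≤s (s≤s ()))
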